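{- There is no $(3,2)$-critical graph that contains exactly three odd cycles.
   Context: Graphs are finite and simple. $\chi(G)$ is the chromatic number. ${\rm es}_{\chi}(G)$ is the minimum number of edges of $G$ whose removal results in a spanning subgraph $G_1$ with $\chi(G_1)=\chi(G)-1$. $G$ is $(3,2)$-critical if $\chi(G)=3$, ${\rm es}_{\chi}(G)=2$, and ${\rm es}_{\chi}(G-e)<{\rm es}_{\chi}(G)$ for every edge $e$. Odd cycles are cycle subgraphs of odd length. -}

module Defs where

open import Data.Nat using (ℕ; zero; suc; _+_; _∸_; _≤_; _<_; _<ᵇ_)
open import Data.Nat.DivMod using (_mod_)
open import Data.Fin using (Fin; toℕ; _≟_)
open import Data.Bool using (Bool; true; false; _∧_; _∨_; not; if_then_else_; T)
open import Data.Bool.Properties using (∧-comm; ∨-comm)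
open import Data.List using (List; map; allFin; cartesianProduct)
open import Data.Nat.ListAction using (sum)
open import Data.Product using (Σ; ∃; _×_; _,_; proj₁; proj₂)
open import Data.Sum using (_⊎_)
open import Function using (Injective)
open import Relation.Nullary using (¬_; ⌊_⌋)
open import Relation.Binary.PropositionalEquality using (_≡_; _≢_; refl; cong; cong₂; trans)

record Graph (n : ℕ) : Set where
  field
    adj    : Fin n → Fin n → Bool
    sym    : ∀ i j → adj i j ≡ adj j i
    irrefl : ∀ i → adj i i ≡ false
open Graph public

_⊆G_ : ∀ {n} → Graph n → Graph n → Set
H ⊆G G = ∀ i j → adj H i j ≡ true → adj G i j ≡ true

edgeCount : ∀ {n} → Graph n → ℕ
edgeCount {n} G =
  sum (map (λ p → if adj G (proj₁ p) (proj₂ p) ∧ (toℕ (proj₁ p) <ᵇ toℕ (proj₂ p)) then 1 else 0)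
           (cartesianProduct (allFin n) (allFin n)))

removed : ∀ {n} → Graph n → Graph n → ℕ
removed G H = edgeCount G ∸ edgeCount H

Colorable : ∀ {n} → Graph n → ℕ → Set
Colorable {n} G k = Σ (Fin n → Fin k) λ c → ∀ i j → adj G i j ≡ true → c i ≢ c j

HasChi : ∀ {n} → Graph n → ℕ → Set
HasChi G k = Colorable G k × (∀ m → m < k → ¬ Colorable G m)

-- es_χ(G) = m : the minimum number of edges whose removal gives a spanning
-- subgraph G₁ with χ(G₁) = χ(G) - 1.
EsChi : ∀ {n} → Graph n → ℕ → Set
EsChi {n} G m =
  Σ ℕ λ k → HasChi G k
    × (Σ (Graph n) λ H → H ⊆G G × HasChi H (k ∸ 1) × removed G H ≡ m)
    × (∀ (H : Graph n) → H ⊆G G → HasChi H (k ∸ 1) → m ≤ removed G H)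

private
  eqb : ∀ {n} → Fin n → Fin n → Bool
  eqb x y = ⌊ x ≟ y ⌋

  isE : ∀ {n} → Fin n → Fin n → Fin n → Fin n → Bool
  isE i j x y = (eqb x i ∧ eqb y j) ∨ (eqb x j ∧ eqb y i)

  isE-sym : ∀ {n} (i j x y : Fin n) → isE i j x y ≡ isE i j y x
  isE-sym i j x y =
    trans (∨-comm (eqb x i ∧ eqb y j) (eqb x j ∧ eqb y i))
          (cong₂ _∨_ (∧-comm (eqb x j) (eqb y i)) (∧-comm (eqb x i) (eqb y j)))

  del-irrefl : ∀ {n} (G : Graph n) (i j x : Fin n) → adj G x x ∧ not (isE i j x x) ≡ false
  del-irrefl G i j x rewrite irrefl G x = refl

deleteEdge : ∀ {n} → Graph n → Fin n → Fin n → Graph n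
deleteEdge G i j = record
  { adj    = λ x y → adj G x y ∧ not (isE i j x y)
  ; sym    = λ x y → cong₂ _∧_ (sym G x y) (cong not (isE-sym i j x y))
  ; irrefl = del-irrefl G i j
  }

Critical32 : ∀ {n} → Graph n → Set
Critical32 G =
  HasChi G 3 × EsChi G 2
    × (∀ i j → adj G i j ≡ true → Σ ℕ λ m → EsChi (deleteEdge G i j) m × m < 2)

next : ∀ {m} → Fin (suc m) → Fin (suc m)
next {m} i = suc (toℕ i) mod (suc m)

-- C (given by its edge set, as a spanning subgraph) is a cycle subgraph of G
-- of odd length 2k+3: there are distinct vertices v₀,…,v_{ℓ-1} such that the
-- edges of C are exactly {vᵢ, vᵢ₊₁ mod ℓ}.
OddCycle : ∀ {n} → Graph n → Graph n → Set
OddCycle {n} G C =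
  C ⊆G G ×
  (Σ ℕ λ k → Σ (Fin (suc (suc (suc (k + k)))) → Fin n) λ v →
     Injective _≡_ _≡_ v ×
     (∀ x y → (adj C x y ≡ true →
                 ∃ λ i → (x ≡ v i × y ≡ v (next i)) ⊎ (y ≡ v i × x ≡ v (next i)))
            × ((∃ λ i → (x ≡ v i × y ≡ v (next i)) ⊎ (y ≡ v i × x ≡ v (next i)))
                 → adj C x y ≡ true)))

SameEdges : ∀ {n} → Graph n → Graph n → Set
SameEdges C D = ∀ x y → adj C x y ≡ adj D x y

ExactlyThreeOddCycles : ∀ {n} → Graph n → Set
ExactlyThreeOddCycles {n} G =
  Σ (Graph n) λ C₁ → Σ (Graph n) λ C₂ → Σ (Graph n) λ C₃ →
    OddCycle G C₁ × OddCycle G C₂ × OddCycle G C₃ ×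
    ¬ SameEdges C₁ C₂ × ¬ SameEdges C₁ C₃ × ¬ SameEdges C₂ C₃ ×
    (∀ C → OddCycle G C → SameEdges C C₁ ⊎ SameEdges C C₂ ⊎ SameEdges C C₃)

module Submission where

-- Let G be (3,2)-critical with odd cycles exactly C₁, C₂, C₃.  The argument uses
-- two general tools developed first:
--   * a parity calculus: ⨁ sums Booleans mod 2; every odd cycle has an odd number
--     of monochromatic edges under any 2-colouring, so the symmetric difference
--     of three odd cycles is not bipartite;
--   * König's theorem in constructive form: every graph is bipartite or contains
--     an odd cycle (a union–find colouring either succeeds or closes an odd walk,
--     and an odd closed walk is shortened to an odd cycle);
-- together with edge counting for removed, and basic facts on chromatic numbers.
-- Criticality then gives: (A) deleting one edge never leaves G bipartite, so no
-- edge lies on all three cycles; (B) two edge-disjoint odd cycles cannot both avoid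
-- an edge e, since a bipartite subgraph of G - e would have to lose two edges.
-- The symmetric difference of C₁, C₂, C₃ is not bipartite, hence contains some Cᵢ;
-- by (A) that Cᵢ is edge-disjoint from the other two, which differ in some edge e,
-- and (B) applied to e yields the contradiction.

open import Defs hiding (sym)
open import Algebra using (CommutativeRing)
open import Data.Bool using (Bool; true; false; _∧_; _∨_; not; _xor_; if_then_else_)
import Data.Bool.Properties as Bool
open import Data.Bool.Properties
  using (¬-not; ∧-identityʳ; ∧-zeroʳ; ∧-distribʳ-xor; not-involutive; not-distribˡ-xor;
         xor-assoc; xor-comm; xor-same; xor-identityʳ; xor-∧-commutativeRing)
open import Data.Empty using (⊥; ⊥-elim)
open import Data.Fin as F using (Fin; toℕ)
open import Data.Fin.Properties
  using (any?; 2↔Bool; inject≤-injective; fromℕ≢inject₁; inject₁-injective; toℕ-injective; toℕ-fromℕ<; toℕ<n)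
  renaming (suc-injective to Fin-suc-injective)
open import Data.List using (List; []; _∷_; map; allFin; cartesianProduct)
open import Data.List.Membership.Propositional using (_∈_)
open import Data.List.Membership.Propositional.Properties using (∈-allFin; ∈-cartesianProduct⁺)
open import Data.List.Relation.Unary.All as All using (All; []; _∷_)
open import Data.List.Relation.Unary.AllPairs using (AllPairs)
open import Data.List.Relation.Unary.Any using (here; there)
open import Data.List.Relation.Unary.Unique.Propositional using (Unique)
import Data.List.Relation.Unary.Unique.Propositional.Properties as UniqueP
open import Data.Nat using (ℕ; zero; suc; _+_; _∸_; _≤_; _<_; _<ᵇ_; z≤n; s≤s; s≤s⁻¹)
open import Data.Nat.DivMod using (_mod_; _%_; m<n⇒m%n≡m; n%n≡0)
open import Data.Nat.ListAction using (sum)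
open import Data.Nat.Properties
  using (_<?_; <-cmp; <-asym; <-irrefl; ≤-refl; ≤-reflexive; ≤-trans; <⇒≤; <-≤-trans; ≤-<-trans;
         +-suc; +-comm; +-mono-≤; +-monoˡ-≤; +-cancelʳ-≡; m∸n+n≡m; m≤n+o⇒m∸n≤o; m+n≤o⇒m≤o∸n;
         m≤n⇒m<n∨m≡n; 1+n≢n; 0≢1+n; suc-injective)
open import Data.Product as Prod using (Σ; ∃; _×_; _,_; proj₁; proj₂)
open import Data.Product.Properties using (≡-dec)
open import Data.Sum as Sum using (_⊎_; inj₁; inj₂)
open import Function using (_∘_; case_of_; Injective)
open import Function.Bundles using (mk⇔; Inverse; Injection)
open import Function.Properties.Inverse using (↔-sym; ↔⇒↣)
open import Relation.Binary.Definitions using (DecidableEquality; tri<; tri≈; tri>)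
open import Relation.Binary.PropositionalEquality
open import Relation.Nullary using (¬_)
open import Relation.Nullary.Decidable
  using (Dec; does; yes; no; map′; toSum; dec-true; dec-false; does-⇔; isYes≗does; _×-dec_; _⊎-dec_)
open import Algebra.Properties.CommutativeSemigroup
  (CommutativeRing.+-commutativeSemigroup xor-∧-commutativeRing) using (interchange)

xor-cancel-middle : ∀ a b c → (a xor b) xor (b xor c) ≡ a xor c
xor-cancel-middle a b c =
  trans (xor-assoc a b (b xor c)) (cong (a xor_) (trans (sym (xor-assoc b b c)) (cong (_xor c) (xor-same b))))

xor-cancelʳ : ∀ a f → (a xor f) xor f ≡ a
xor-cancelʳ a f = trans (xor-assoc a f f) (trans (cong (a xor_) (xor-same f)) (xor-identityʳ a))

xor-flip-both : ∀ a b f → (a xor f) xor (b xor f) ≡ a xor b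
xor-flip-both a b f =
  trans (interchange a f b f) (trans (cong ((a xor b) xor_) (xor-same f)) (xor-identityʳ (a xor b)))

xor-flip-≢ : ∀ {a b} f → a ≢ b → a xor f ≢ b xor f
xor-flip-≢ {a} {b} f a≢b e = a≢b (trans (sym (xor-cancelʳ a f)) (trans (cong (_xor f) e) (xor-cancelʳ b f)))

≢⇒xor : ∀ {a b} → a ≢ b → a xor b ≡ true
≢⇒xor {false} {false} a≢b = ⊥-elim (a≢b refl)
≢⇒xor {false} {true}  _   = refl
≢⇒xor {true}  {false} _   = refl
≢⇒xor {true}  {true}  a≢b = ⊥-elim (a≢b refl)

does-true : ∀ {A : Set} (a? : Dec A) → does a? ≡ true → A
does-true (yes a) _ = a

∧-true : ∀ a {b} → a ∧ b ≡ true → a ≡ true × b ≡ true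
∧-true true {true} _ = refl , refl

⨁ : ∀ {m} → (Fin m → Bool) → Bool
⨁ {zero}  f = false
⨁ {suc m} f = f F.zero xor ⨁ (f ∘ F.suc)

⨁-cong : ∀ {m} {f g : Fin m → Bool} → (∀ t → f t ≡ g t) → ⨁ f ≡ ⨁ g
⨁-cong {zero}  e = refl
⨁-cong {suc m} e = cong₂ _xor_ (e F.zero) (⨁-cong (e ∘ F.suc))

⨁-xor : ∀ {m} (f g : Fin m → Bool) → ⨁ (λ t → f t xor g t) ≡ ⨁ f xor ⨁ g
⨁-xor {zero}  f g = refl
⨁-xor {suc m} f g =
  trans (cong ((f F.zero xor g F.zero) xor_) (⨁-xor (f ∘ F.suc) (g ∘ F.suc)))
        (interchange (f F.zero) (g F.zero) (⨁ (f ∘ F.suc)) (⨁ (g ∘ F.suc)))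

⨁-zero : ∀ {m} (f : Fin m → Bool) → (∀ t → f t ≡ false) → ⨁ f ≡ false
⨁-zero {zero}  f z = refl
⨁-zero {suc m} f z rewrite z F.zero = ⨁-zero (f ∘ F.suc) (z ∘ F.suc)

⨁-single : ∀ {m} (f : Fin m → Bool) (t₀ : Fin m) → (∀ t → f t ≡ true → t ≡ t₀) → ⨁ f ≡ f t₀
⨁-single {suc m} f F.zero only =
  trans (cong (f F.zero xor_) (⨁-zero (f ∘ F.suc) off)) (xor-identityʳ (f F.zero))
  where
  off : ∀ t → f (F.suc t) ≡ false
  off t with f (F.suc t) in e
  ... | false = refl
  ... | true with only (F.suc t) e
  ...   | ()
⨁-single {suc m} f (F.suc t₀) only with f F.zero in e
... | true with only F.zero e
...   | ()
⨁-single {suc m} f (F.suc t₀) only | false =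
  ⨁-single (f ∘ F.suc) t₀ (λ t ft → Fin-suc-injective (only (F.suc t) ft))

⨁-swap : ∀ {m k} (f : Fin m → Fin k → Bool) → ⨁ (λ a → ⨁ (f a)) ≡ ⨁ (λ b → ⨁ (λ a → f a b))
⨁-swap {zero}  {k} f = sym (⨁-zero {k} _ (λ _ → refl))
⨁-swap {suc m} {k} f =
  trans (cong (⨁ (f F.zero) xor_) (⨁-swap (f ∘ F.suc)))
        (sym (⨁-xor (f F.zero) (λ b → ⨁ (λ a → f (F.suc a) b))))

⨁-∧ : ∀ {m} (f : Fin m → Bool) c → ⨁ f ∧ c ≡ ⨁ (λ t → f t ∧ c)
⨁-∧ {zero}  f c = refl
⨁-∧ {suc m} f c =
  trans (∧-distribʳ-xor c (f F.zero) _) (cong ((f F.zero ∧ c) xor_) (⨁-∧ (f ∘ F.suc) c))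

⨁²-single : ∀ {m} (f : Fin m → Fin m → Bool) (a₀ b₀ : Fin m) →
            (∀ a b → f a b ≡ true → a ≡ a₀ × b ≡ b₀) → ⨁ (λ a → ⨁ (f a)) ≡ f a₀ b₀
⨁²-single f a₀ b₀ only =
  trans (⨁-single (λ a → ⨁ (f a)) a₀ row) (⨁-single (f a₀) b₀ (λ b e → proj₂ (only a₀ b e)))
  where
  row : ∀ a → ⨁ (f a) ≡ true → a ≡ a₀
  row a e with a F.≟ a₀
  ... | yes a≡a₀ = a≡a₀
  ... | no a≢a₀ with trans (sym e) (⨁-zero (f a) off)
    where
    off : ∀ b → f a b ≡ false
    off b with f a b in fab
    ... | false = refl
    ... | true = ⊥-elim (a≢a₀ (proj₁ (only a b fab)))
  ...   | ()

odd : ℕ → Bool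
odd zero    = false
odd (suc n) = not (odd n)

odd-double : ∀ k → odd (k + k) ≡ false
odd-double zero    = refl
odd-double (suc k) rewrite +-suc k k | odd-double k = refl

odd-cycleLength : ∀ k → odd (suc (suc (suc (k + k)))) ≡ true
odd-cycleLength k rewrite odd-double k = refl

odd-+ : ∀ a b → odd (a + b) ≡ odd a xor odd b
odd-+ zero    b = refl
odd-+ (suc a) b = trans (cong not (odd-+ a b)) (not-distribˡ-xor (odd a) (odd b))

odd⇒cycleLength : ∀ j → odd (suc (suc j)) ≡ true → Σ ℕ λ k → suc (suc j) ≡ suc (suc (suc (k + k)))
odd⇒cycleLength zero            ()
odd⇒cycleLength (suc zero)      _ = 0 , refl
odd⇒cycleLength (suc (suc j)) o with odd⇒cycleLength j (trans (sym (not-involutive (odd (suc (suc j))))) o)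
... | k , eq = suc k , trans (cong (suc ∘ suc) eq) (cong (suc ∘ suc ∘ suc ∘ suc) (sym (+-suc k k)))

⨁-true : ∀ m → ⨁ {m} (λ _ → true) ≡ odd m
⨁-true zero    = refl
⨁-true (suc m) = cong not (⨁-true m)

⨁-telescope : ∀ m (g : ℕ → Bool) → ⨁ {m} (λ t → g (toℕ t) xor g (suc (toℕ t))) ≡ g 0 xor g m
⨁-telescope zero    g = sym (xor-same (g 0))
⨁-telescope (suc m) g =
  trans (cong ((g 0 xor g 1) xor_) (⨁-telescope m (g ∘ suc))) (xor-cancel-middle (g 0) (g 1) (g (suc m)))

toℕ-mod : ∀ {m} (t : Fin (suc m)) → toℕ t mod suc m ≡ t
toℕ-mod t = toℕ-injective (trans (toℕ-fromℕ< _) (m<n⇒m%n≡m (toℕ<n t)))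

length-mod : ∀ m → suc m mod suc m ≡ 0 mod suc m
length-mod m = toℕ-injective (trans (toℕ-fromℕ< _) (trans (n%n≡0 (suc m)) (sym (toℕ-fromℕ< {m = 0} {n = suc m} (s≤s z≤n)))))

next-cases : ∀ {m} (t : Fin (suc m)) →
             toℕ (next t) ≡ suc (toℕ t) ⊎ (toℕ t ≡ m × toℕ (next t) ≡ 0)
next-cases {m} t with m≤n⇒m<n∨m≡n (s≤s⁻¹ (toℕ<n t))
... | inj₁ t<m  = inj₁ (trans (toℕ-fromℕ< _) (m<n⇒m%n≡m (s≤s t<m)))
... | inj₂ t≡m = inj₂ (t≡m , trans (toℕ-fromℕ< _) (trans (cong (λ i → suc i % suc m) t≡m) (n%n≡0 (suc m))))

next-≢ : ∀ {j} (t : Fin (suc (suc j))) → next t ≢ t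
next-≢ t e with next-cases t
... | inj₁ q       = 1+n≢n (trans (sym q) (cong toℕ e))
... | inj₂ (p , q) = 0≢1+n (trans (sym q) (trans (cong toℕ e) p))

next²-≢ : ∀ {j} (t : Fin (suc (suc (suc j)))) → next (next t) ≢ t
next²-≢ t e with next-cases t | next-cases (next t) | cong toℕ e
... | inj₁ q       | inj₁ q'        | e' = n≢2+n (trans (sym e') (trans q' (cong suc q)))
  where
  n≢2+n : ∀ {a} → a ≢ suc (suc a)
  n≢2+n ()
... | inj₁ q       | inj₂ (p' , q') | e' =
  0≢1+n (suc-injective (trans (sym (trans q (cong suc (trans (sym e') q')))) p'))
... | inj₂ (p , q) | inj₁ q'        | e' = 0≢1+n (suc-injective (trans (sym (trans q' (cong suc q))) (trans e' p)))
... | inj₂ (p , q) | inj₂ (p' , q') | e' = 0≢1+n (trans (sym q) p')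

steady-parity : ∀ m (h : Fin (suc m) → Bool) → ⨁ (λ t → not (h t xor h (next t))) ≡ odd (suc m)
steady-parity m h =
  begin
    ⨁ (λ t → true xor (h t xor h (next t)))
  ≡⟨ ⨁-xor (λ _ → true) (λ t → h t xor h (next t)) ⟩
    ⨁ {suc m} (λ _ → true) xor ⨁ (λ t → h t xor h (next t))
  ≡⟨ cong₂ _xor_ (⨁-true (suc m)) (⨁-cong (λ t → cong (λ s → h s xor h (next t)) (sym (toℕ-mod t)))) ⟩
    odd (suc m) xor ⨁ {suc m} (λ t → h′ (toℕ t) xor h′ (suc (toℕ t)))
  ≡⟨ cong (odd (suc m) xor_) (⨁-telescope (suc m) h′) ⟩
    odd (suc m) xor (h′ 0 xor h (suc m mod suc m))
  ≡⟨ cong (λ s → odd (suc m) xor (h′ 0 xor h s)) (length-mod m) ⟩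
    odd (suc m) xor (h′ 0 xor h′ 0)
  ≡⟨ cong (odd (suc m) xor_) (xor-same (h′ 0)) ⟩
    odd (suc m) xor false
  ≡⟨ xor-identityʳ (odd (suc m)) ⟩
    odd (suc m)
  ∎
  where
  open ≡-Reasoning
  h′ : ℕ → Bool
  h′ i = h (i mod suc m)

adj-≢ : ∀ {n} (G : Graph n) {x y} → adj G x y ≡ true → x ≢ y
adj-≢ G {x} e refl = case trans (sym e) (Graph.irrefl G x) of λ ()

_<ᶠ_ : ∀ {n} → Fin n → Fin n → Bool
x <ᶠ y = toℕ x <ᵇ toℕ y

<ᶠ-orient : ∀ {n} {x y : Fin n} → x ≢ y →
            (x <ᶠ y ≡ true × y <ᶠ x ≡ false) ⊎ (x <ᶠ y ≡ false × y <ᶠ x ≡ true)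
<ᶠ-orient {x = x} {y} x≢y with <-cmp (toℕ x) (toℕ y)
... | tri< x<y _ _ = inj₁ (dec-true (toℕ x <? toℕ y) x<y , dec-false (toℕ y <? toℕ x) (<-asym x<y))
... | tri≈ _ x≡y _ = ⊥-elim (x≢y (toℕ-injective x≡y))
... | tri> _ _ y<x = inj₂ (dec-false (toℕ x <? toℕ y) (<-asym y<x) , dec-true (toℕ y <? toℕ x) y<x)

SamePair : ∀ {n} → Fin n → Fin n → Fin n → Fin n → Set
SamePair a b x y = (x ≡ a × y ≡ b) ⊎ (y ≡ a × x ≡ b)

samePair? : ∀ {n} (a b x y : Fin n) → Dec (SamePair a b x y)
samePair? a b x y = ((x F.≟ a) ×-dec (y F.≟ b)) ⊎-dec ((y F.≟ a) ×-dec (x F.≟ b))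

SamePair-flip : ∀ {n} {a b x y : Fin n} → SamePair a b x y → SamePair b a x y
SamePair-flip = Sum.swap ∘ Sum.map Prod.swap Prod.swap

edgeParity : ∀ {n} → (Fin n → Fin n → Bool) → (Fin n → Fin n → Bool) → Bool
edgeParity A P = ⨁ λ x → ⨁ λ y → A x y ∧ (P x y ∧ x <ᶠ y)

edgeParity-oriented : ∀ {n} (a b : Fin n) → a <ᶠ b ≡ true → b <ᶠ a ≡ false → (P : Fin n → Fin n → Bool) →
                      edgeParity (λ x y → does (samePair? a b x y)) P ≡ P a b
edgeParity-oriented {n} a b a<b b≮a P = trans (⨁²-single term a b only) value
  where
  term : Fin n → Fin n → Bool
  term x y = does (samePair? a b x y) ∧ (P x y ∧ x <ᶠ y)
  only : ∀ x y → term x y ≡ true → x ≡ a × y ≡ b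
  only x y e with ∧-true (does (samePair? a b x y)) e
  ... | s , rest with does-true (samePair? a b x y) s | ∧-true (P x y) rest
  ...   | inj₁ x,y≡a,b       | _       = x,y≡a,b
  ...   | inj₂ (refl , refl) | _ , b<a = case trans (sym b≮a) b<a of λ ()
  value : term a b ≡ P a b
  value rewrite dec-true (samePair? a b a b) (inj₁ (refl , refl)) | a<b = ∧-identityʳ (P a b)

edgeParity-pair : ∀ {n} (a b : Fin n) → a ≢ b → (P : Fin n → Fin n → Bool) → (∀ x y → P x y ≡ P y x) →
                  edgeParity (λ x y → does (samePair? a b x y)) P ≡ P a b
edgeParity-pair a b a≢b P P-sym with <ᶠ-orient a≢b
... | inj₁ (a<b , b≮a) = edgeParity-oriented a b a<b b≮a P
... | inj₂ (a≮b , b<a) =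
  trans (⨁-cong λ x → ⨁-cong λ y → cong (_∧ _) (does-⇔ (mk⇔ SamePair-flip SamePair-flip) (samePair? a b x y) (samePair? b a x y)))
        (trans (edgeParity-oriented b a b<a a≮b P) (P-sym b a))

Step : ∀ {n m} → (Fin (suc m) → Fin n) → Fin (suc m) → Fin n → Fin n → Set
Step v t = SamePair (v t) (v (next t))

step? : ∀ {n m} (v : Fin (suc m) → Fin n) t x y → Dec (Step v t x y)
step? v t = samePair? (v t) (v (next t))

Traces : ∀ {n m} → Graph n → (Fin (suc m) → Fin n) → Set
Traces C v = ∀ x y → (adj C x y ≡ true → ∃ λ t → Step v t x y) × ((∃ λ t → Step v t x y) → adj C x y ≡ true)

module Traced {n m} {C : Graph n} {v : Fin (suc (suc (suc m))) → Fin n}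
              (v-inj : Injective _≡_ _≡_ v) (traces : Traces C v) where

  step-≢ : ∀ t → v t ≢ v (next t)
  step-≢ t e = next-≢ t (sym (v-inj e))

  -- A pair of vertices is the step of at most one position (this needs length ≥ 3).
  step-unique : ∀ {t s x y} → Step v t x y → Step v s x y → s ≡ t
  step-unique (inj₁ (x≡ , _))  (inj₁ (x≡′ , _)) = v-inj (trans (sym x≡′) x≡)
  step-unique (inj₂ (y≡ , _))  (inj₂ (y≡′ , _)) = v-inj (trans (sym y≡′) y≡)
  step-unique {t} {s} (inj₁ (x≡ , y≡)) (inj₂ (y≡′ , x≡′)) =
    ⊥-elim (next²-≢ s (trans (cong next (sym t≡)) (v-inj (trans (sym y≡) y≡′))))
    where
    t≡ : t ≡ next s
    t≡ = v-inj (trans (sym x≡) x≡′)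
  step-unique {t} {s} (inj₂ (y≡ , x≡)) (inj₁ (x≡′ , y≡′)) =
    ⊥-elim (next²-≢ t (trans (cong next (sym s≡)) (v-inj (trans (sym y≡′) y≡))))
    where
    s≡ : s ≡ next t
    s≡ = v-inj (trans (sym x≡′) x≡)

  adj-⨁ : ∀ x y → adj C x y ≡ ⨁ (λ t → does (step? v t x y))
  adj-⨁ x y with adj C x y in e
  ... | true with proj₁ (traces x y) e
  ...   | t , st = sym (trans (⨁-single _ t only) (dec-true (step? v t x y) st))
    where
    only : ∀ s → does (step? v s x y) ≡ true → s ≡ t
    only s ds = step-unique st (does-true (step? v s x y) ds)
  adj-⨁ x y | false = sym (⨁-zero _ off)
    where
    off : ∀ s → does (step? v s x y) ≡ false
    off s = dec-false (step? v s x y) (λ st → case trans (sym e) (proj₂ (traces x y) (s , st)) of λ ())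

  edgeParity-steps : (P : Fin n → Fin n → Bool) → (∀ x y → P x y ≡ P y x) →
                     edgeParity (adj C) P ≡ ⨁ (λ t → P (v t) (v (next t)))
  edgeParity-steps P P-sym =
    begin
      edgeParity (adj C) P
    ≡⟨ ⨁-cong (λ x → ⨁-cong (λ y → trans (cong (_∧ Q x y) (adj-⨁ x y)) (⨁-∧ (λ t → S t x y) (Q x y)))) ⟩
      ⨁ (λ x → ⨁ (λ y → ⨁ (λ t → S t x y ∧ Q x y)))
    ≡⟨ ⨁-cong (λ x → ⨁-swap (λ y t → S t x y ∧ Q x y)) ⟩
      ⨁ (λ x → ⨁ (λ t → ⨁ (λ y → S t x y ∧ Q x y)))
    ≡⟨ ⨁-swap (λ x t → ⨁ (λ y → S t x y ∧ Q x y)) ⟩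
      ⨁ (λ t → edgeParity (S t) P)
    ≡⟨ ⨁-cong (λ t → edgeParity-pair (v t) (v (next t)) (step-≢ t) P P-sym) ⟩
      ⨁ (λ t → P (v t) (v (next t)))
    ∎
    where
    open ≡-Reasoning
    S : Fin (suc (suc (suc m))) → Fin n → Fin n → Bool
    S t x y = does (step? v t x y)
    Q : Fin n → Fin n → Bool
    Q x y = P x y ∧ x <ᶠ y

Bipartite : ∀ {n} → Graph n → Set
Bipartite {n} Y = Σ (Fin n → Bool) λ c → ∀ x y → adj Y x y ≡ true → c x ≢ c y

bipartite⇒2-colourable : ∀ {n} {Y : Graph n} → Bipartite Y → Colorable Y 2
bipartite⇒2-colourable (c , proper) = unbit ∘ c , λ x y e → proper x y e ∘ unbit-injective
  where
  unbit : Bool → Fin 2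
  unbit = Inverse.to (↔-sym 2↔Bool)
  unbit-injective : Injective _≡_ _≡_ unbit
  unbit-injective = Injection.injective (↔⇒↣ (↔-sym 2↔Bool))

2-colourable⇒bipartite : ∀ {n} {Y : Graph n} → Colorable Y 2 → Bipartite Y
2-colourable⇒bipartite (c , proper) = bit ∘ c , λ x y e → proper x y e ∘ bit-injective
  where
  bit : Fin 2 → Bool
  bit = Inverse.to 2↔Bool
  bit-injective : Injective _≡_ _≡_ bit
  bit-injective = Injection.injective (↔⇒↣ 2↔Bool)

agree : ∀ {n} → (Fin n → Bool) → Fin n → Fin n → Bool
agree c x y = not (c x xor c y)

agree-sym : ∀ {n} (c : Fin n → Bool) x y → agree c x y ≡ agree c y x
agree-sym c x y = cong not (xor-comm (c x) (c y))

edgeParity-xor : ∀ {n} (A B P : Fin n → Fin n → Bool) →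
                 edgeParity (λ x y → A x y xor B x y) P ≡ edgeParity A P xor edgeParity B P
edgeParity-xor A B P =
  trans (⨁-cong λ x → trans (⨁-cong λ y → ∧-distribʳ-xor (P x y ∧ x <ᶠ y) (A x y) (B x y))
                            (⨁-xor (λ y → A x y ∧ (P x y ∧ x <ᶠ y)) (λ y → B x y ∧ (P x y ∧ x <ᶠ y))))
        (⨁-xor (λ x → ⨁ λ y → A x y ∧ (P x y ∧ x <ᶠ y)) (λ x → ⨁ λ y → B x y ∧ (P x y ∧ x <ᶠ y)))

edgeParity-proper : ∀ {n} (A : Fin n → Fin n → Bool) (c : Fin n → Bool) →
                    (∀ x y → A x y ≡ true → c x ≢ c y) → edgeParity A (agree c) ≡ false
edgeParity-proper A c proper = ⨁-zero _ λ x → ⨁-zero _ λ y → monochromatic-free x y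
  where
  monochromatic-free : ∀ x y → A x y ∧ (agree c x y ∧ x <ᶠ y) ≡ false
  monochromatic-free x y with A x y in e | c x Bool.≟ c y
  ... | false | _       = refl
  ... | true  | yes same = ⊥-elim (proper x y e same)
  ... | true  | no diff  = cong (λ d → not d ∧ (x <ᶠ y)) (≢⇒xor diff)

oddCycle-monochromatic : ∀ {n} {G C : Graph n} → OddCycle G C → (c : Fin n → Bool) → edgeParity (adj C) (agree c) ≡ true
oddCycle-monochromatic {C = C} (_ , k , v , v-inj , traces) c =
  trans (Traced.edgeParity-steps {C = C} v-inj traces (agree c) (agree-sym c))
        (trans (steady-parity _ (c ∘ v)) (odd-cycleLength k))

oddCycle-not-bipartite : ∀ {n} {G C Y : Graph n} → OddCycle G C → C ⊆G Y → ¬ Bipartite Y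
oddCycle-not-bipartite {G = G} {C} odd C⊆Y (c , proper) =
  case trans (sym (oddCycle-monochromatic {G = G} {C} odd c)) (edgeParity-proper (adj C) c (λ x y e → proper x y (C⊆Y x y e))) of λ ()

module Walks {n} (Y : Graph n) where

  infixr 5 _∷_
  data Walk : Fin n → Fin n → Bool → Set where
    []  : ∀ {x} → Walk x x false
    _∷_ : ∀ {x y z b} → adj Y x y ≡ true → Walk y z b → Walk x z (not b)

  retype : ∀ {x y b b′} → b ≡ b′ → Walk x y b → Walk x y b′
  retype refl w = w

  _++_ : ∀ {x y z a b} → Walk x y a → Walk y z b → Walk x z (a xor b)
  []                 ++ w′ = w′
  _∷_ {b = a} e w ++ w′ = retype (not-distribˡ-xor a _) (e ∷ (w ++ w′))

  reverse : ∀ {x y b} → Walk x y b → Walk y x b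
  reverse []               = []
  reverse (_∷_ {b = b} e w) = retype (xor-comm b true) (reverse w ++ (trans (Graph.sym Y _ _) e ∷ []))

  OddClosedWalk : Set
  OddClosedWalk = Σ (Fin n) λ x → Walk x x true

  record Coherent (c : Fin n → Bool) (x y : Fin n) : Set where
    constructor coherent
    field walk : Walk x y (c x xor c y)

  _▸_ : ∀ {c x y z} → Coherent c x y → Coherent c y z → Coherent c x z
  _▸_ {c} {x} {y} {z} (coherent w) (coherent w′) = coherent (retype (xor-cancel-middle (c x) (c y) (c z)) (w ++ w′))

  reverseᶜ : ∀ {c x y} → Coherent c x y → Coherent c y x
  reverseᶜ {c} {x} {y} (coherent w) = coherent (retype (xor-comm (c x) (c y)) (reverse w))

  edgeᶜ : ∀ {c x y} → adj Y x y ≡ true → c x ≢ c y → Coherent c x y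
  edgeᶜ e c≢ = coherent (retype (sym (≢⇒xor c≢)) (e ∷ []))

  recolour : ∀ {c c′ x y} → c′ x xor c′ y ≡ c x xor c y → Coherent c x y → Coherent c′ x y
  recolour eq (coherent w) = coherent (retype (sym eq) w)

flip-separates : ∀ a b → a ≢ b xor not (a xor b)
flip-separates false false ()
flip-separates false true  ()
flip-separates true  false ()
flip-separates true  true  ()

-- The colouring procedure behind König's theorem: the vertex pairs are handled one
-- at a time, maintaining a union–find style partial 2-colouring; an edge inside a
-- class whose ends have the same colour closes an odd walk.
module Colouring {n} (Y : Graph n) where
  open Walks Y

  record Partial (L : List (Fin n × Fin n)) : Set where
    field
      col      : Fin n → Bool
      rep      : Fin n → Fin n
      rep-idem : ∀ x → rep (rep x) ≡ rep x
      toRep    : ∀ x → Coherent col x (rep x)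
      proper   : ∀ {x y} → (x , y) ∈ L → adj Y x y ≡ true → col x ≢ col y
      closed   : ∀ {x y} → (x , y) ∈ L → adj Y x y ≡ true → rep x ≡ rep y

  start : Partial []
  start = record { col = λ _ → false ; rep = λ z → z ; rep-idem = λ _ → refl ; toRep = λ _ → coherent []
                 ; proper = λ () ; closed = λ () }

  keep : ∀ {L u v} (s : Partial L) →
         (adj Y u v ≡ true → Partial.col s u ≢ Partial.col s v × Partial.rep s u ≡ Partial.rep s v) →
         Partial ((u , v) ∷ L)
  keep s ok = record
    { col = col ; rep = rep ; rep-idem = rep-idem ; toRep = toRep
    ; proper = λ { (here refl) e → proj₁ (ok e) ; (there m) → proper m }
    ; closed = λ { (here refl) e → proj₂ (ok e) ; (there m) → closed m } }
    where open Partial s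

  -- Merging the class of v into the class of u across the edge {u , v}; the colours
  -- of v's class are flipped when u and v have the same colour.
  module Merge {L} (s : Partial L) {u v} (uv : adj Y u v ≡ true) (apart : Partial.rep s u ≢ Partial.rep s v) where
    open Partial s using (col; rep; rep-idem; toRep; proper; closed)

    flip : Bool
    flip = not (col u xor col v)

    col′ : Fin n → Bool
    col′ z with rep z F.≟ rep v
    ... | yes _ = col z xor flip
    ... | no  _ = col z

    rep′ : Fin n → Fin n
    rep′ z with rep z F.≟ rep v
    ... | yes _ = rep u
    ... | no  _ = rep z

    moved : ∀ {z} → rep z ≡ rep v → col′ z ≡ col z xor flip × rep′ z ≡ rep u
    moved {z} p with rep z F.≟ rep v
    ... | yes _ = refl , refl
    ... | no ¬p = ⊥-elim (¬p p)

    kept : ∀ {z} → rep z ≢ rep v → col′ z ≡ col z × rep′ z ≡ rep z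
    kept {z} ¬p with rep z F.≟ rep v
    ... | yes p = ⊥-elim (¬p p)
    ... | no  _ = refl , refl

    rep-kept : ∀ {z} → rep z ≢ rep v → rep (rep z) ≢ rep v
    rep-kept {z} ¬p q = ¬p (trans (sym (rep-idem z)) q)

    side : ∀ z → rep z ≡ rep v ⊎ rep z ≢ rep v
    side z = toSum (rep z F.≟ rep v)

    rep-idem′ : ∀ z → rep′ (rep′ z) ≡ rep′ z
    rep-idem′ z = Sum.[ when-moved , when-kept ]′ (side z)
      where
      when-moved : rep z ≡ rep v → rep′ (rep′ z) ≡ rep′ z
      when-moved p rewrite proj₂ (moved p) = trans (proj₂ (kept (rep-kept apart))) (rep-idem u)
      when-kept : rep z ≢ rep v → rep′ (rep′ z) ≡ rep′ z
      when-kept ¬p rewrite proj₂ (kept ¬p) = trans (proj₂ (kept (rep-kept ¬p))) (rep-idem z)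

    coherent-moved : ∀ {x y} → rep x ≡ rep v → rep y ≡ rep v → Coherent col x y → Coherent col′ x y
    coherent-moved {x} {y} px py =
      recolour (trans (cong₂ _xor_ (proj₁ (moved px)) (proj₁ (moved py))) (xor-flip-both (col x) (col y) flip))

    coherent-kept : ∀ {x y} → rep x ≢ rep v → rep y ≢ rep v → Coherent col x y → Coherent col′ x y
    coherent-kept px py = recolour (cong₂ _xor_ (proj₁ (kept px)) (proj₁ (kept py)))

    uv-separated : col′ u ≢ col′ v
    uv-separated rewrite proj₁ (kept apart) | proj₁ (moved {v} refl) = flip-separates (col u) (col v)

    -- A moved vertex reaches rep u through v and across the new edge.
    toRep′ : ∀ z → Coherent col′ z (rep′ z)
    toRep′ z = Sum.[ via-v , directly ]′ (side z)
      where
      via-v : rep z ≡ rep v → Coherent col′ z (rep′ z)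
      via-v p = subst (Coherent col′ z) (sym (proj₂ (moved p)))
        (coherent-moved p (rep-idem v) (subst (Coherent col z) p (toRep z))
         ▸ (coherent-moved (rep-idem v) refl (reverseᶜ (toRep v))
         ▸ (edgeᶜ (trans (Graph.sym Y v u) uv) (uv-separated ∘ sym)
         ▸ coherent-kept apart (rep-kept apart) (toRep u))))
      directly : rep z ≢ rep v → Coherent col′ z (rep′ z)
      directly ¬p = subst (Coherent col′ z) (sym (proj₂ (kept ¬p))) (coherent-kept ¬p (rep-kept ¬p) (toRep z))

    -- Handled edges stay inside one side, so they stay properly coloured and closed.
    proper′ : ∀ {x y} → (x , y) ∈ (u , v) ∷ L → adj Y x y ≡ true → col′ x ≢ col′ y
    proper′ (here refl) _ = uv-separated
    proper′ {x} {y} (there m) e = Sum.[ when-moved , when-kept ]′ (side x)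
      where
      when-moved : rep x ≡ rep v → col′ x ≢ col′ y
      when-moved p = subst₂ _≢_ (sym (proj₁ (moved p))) (sym (proj₁ (moved (trans (sym (closed m e)) p))))
                                (xor-flip-≢ flip (proper m e))
      when-kept : rep x ≢ rep v → col′ x ≢ col′ y
      when-kept ¬p = subst₂ _≢_ (sym (proj₁ (kept ¬p))) (sym (proj₁ (kept (¬p ∘ trans (closed m e)))))
                                (proper m e)

    closed′ : ∀ {x y} → (x , y) ∈ (u , v) ∷ L → adj Y x y ≡ true → rep′ x ≡ rep′ y
    closed′ (here refl) _ = trans (proj₂ (kept apart)) (sym (proj₂ (moved {v} refl)))
    closed′ {x} {y} (there m) e = Sum.[ when-moved , when-kept ]′ (side x)
      where
      when-moved : rep x ≡ rep v → rep′ x ≡ rep′ y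
      when-moved p = trans (proj₂ (moved p)) (sym (proj₂ (moved (trans (sym (closed m e)) p))))
      when-kept : rep x ≢ rep v → rep′ x ≡ rep′ y
      when-kept ¬p = trans (proj₂ (kept ¬p)) (trans (closed m e) (sym (proj₂ (kept (¬p ∘ trans (closed m e))))))

    merged : Partial ((u , v) ∷ L)
    merged = record { col = col′ ; rep = rep′ ; rep-idem = rep-idem′ ; toRep = toRep′
                    ; proper = proper′ ; closed = closed′ }

  handle : ∀ {L} → Partial L → ∀ u v → Partial ((u , v) ∷ L) ⊎ OddClosedWalk
  handle s u v with adj Y u v in uv
  ... | false = inj₁ (keep s (λ e → case trans (sym uv) e of λ ()))
  ... | true with Partial.rep s u F.≟ Partial.rep s v
  ...   | no apart = inj₁ (Merge.merged s uv apart)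
  ...   | yes same with Partial.col s u Bool.≟ Partial.col s v
  ...     | no differ = inj₁ (keep s (λ _ → differ , same))
  ...     | yes equal = inj₂ (u , retype parity (Coherent.walk u⇝v ++ (trans (Graph.sym Y v u) uv ∷ [])))
    where
    open Partial s
    u⇝v : Coherent col u v
    u⇝v = toRep u ▸ subst (λ r → Coherent col r v) (sym same) (reverseᶜ (toRep v))
    parity : (col u xor col v) xor true ≡ true
    parity = cong (_xor true) (trans (cong (_xor col v) equal) (xor-same (col v)))

  handleAll : ∀ L → Partial L ⊎ OddClosedWalk
  handleAll []            = inj₁ start
  handleAll ((u , v) ∷ L) = Sum.[ (λ s → handle s u v) , inj₂ ]′ (handleAll L)

  bipartite-or-oddWalk : Bipartite Y ⊎ OddClosedWalk
  bipartite-or-oddWalk = Sum.map₁ colouring (handleAll (cartesianProduct (allFin n) (allFin n)))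
    where
    colouring : Partial (cartesianProduct (allFin n) (allFin n)) → Bipartite Y
    colouring s = Partial.col s , λ x y → Partial.proper s (∈-cartesianProduct⁺ (∈-allFin x) (∈-allFin y))

_◂_ : ∀ {n} → Fin n → (ℕ → Fin n) → ℕ → Fin n
(x ◂ f) zero    = x
(x ◂ f) (suc i) = f i

module Cycles {n} (Y : Graph n) where
  open Walks Y

  record Path (x y : Fin n) (b : Bool) : Set where
    field
      len    : ℕ
      f      : ℕ → Fin n
      start  : f 0 ≡ x
      end    : f len ≡ y
      f-inj  : ∀ i j → i ≤ len → j ≤ len → f i ≡ f j → i ≡ j
      f-adj  : ∀ i → i < len → adj Y (f i) (f (suc i)) ≡ true
      parity : odd len ≡ b

  record IsCycle (g : ℕ → Fin n) (ℓ : ℕ) : Set where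
    field
      g-inj  : ∀ i j → i < ℓ → j < ℓ → g i ≡ g j → i ≡ j
      g-adj  : ∀ i → i < ℓ → adj Y (g i) (g (suc i)) ≡ true
      closes : g ℓ ≡ g 0

  OddCycleSeq : Set
  OddCycleSeq = Σ ℕ λ k → Σ (ℕ → Fin n) λ g → IsCycle g (suc (suc (suc (k + k))))

  trivialPath : ∀ {x} → Path x x false
  trivialPath {x} = record { len = 0 ; f = λ _ → x ; start = refl ; end = refl
                           ; f-inj = λ { _ _ z≤n z≤n _ → refl } ; f-adj = λ _ () ; parity = refl }

  module _ {x₁ y b} (P : Path x₁ y b) where
    open Path P

    find : ∀ x → (∀ i → i ≤ len → f i ≢ x) ⊎ (Σ ℕ λ j → j ≤ len × f j ≡ x)
    find x with any? (λ (i : Fin (suc len)) → f (toℕ i) F.≟ x)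
    ... | yes (i , fi≡x) = inj₂ (toℕ i , s≤s⁻¹ (toℕ<n i) , fi≡x)
    ... | no absent = inj₁ λ i i≤len fi≡x →
          absent (F.fromℕ< (s≤s i≤len) , subst (λ j → f j ≡ x) (sym (toℕ-fromℕ< (s≤s i≤len))) fi≡x)

    extend : ∀ {x} → adj Y x x₁ ≡ true → (∀ i → i ≤ len → f i ≢ x) → Path x y (not b)
    extend {x} e fresh = record
      { len = suc len ; f = x ◂ f ; start = refl ; end = end
      ; f-inj = inj ; f-adj = adjacent ; parity = cong not parity }
      where
      inj : ∀ i j → i ≤ suc len → j ≤ suc len → (x ◂ f) i ≡ (x ◂ f) j → i ≡ j
      inj zero    zero    _  _  _ = refl
      inj zero    (suc j) _  lj q = ⊥-elim (fresh j (s≤s⁻¹ lj) (sym q))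
      inj (suc i) zero    li _  q = ⊥-elim (fresh i (s≤s⁻¹ li) q)
      inj (suc i) (suc j) li lj q = cong suc (f-inj i j (s≤s⁻¹ li) (s≤s⁻¹ lj) q)
      adjacent : ∀ i → i < suc len → adj Y ((x ◂ f) i) ((x ◂ f) (suc i)) ≡ true
      adjacent zero    _ = subst (λ z → adj Y x z ≡ true) (sym start) e
      adjacent (suc i) l = f-adj i (s≤s⁻¹ l)

    shortcut : ∀ {x} j → j ≤ len → f j ≡ x → odd j ≡ true → Path x y (not b)
    shortcut j j≤len fj≡x odd-j = record
      { len = len ∸ j ; f = λ i → f (i + j) ; start = fj≡x
      ; end = trans (cong f (m∸n+n≡m j≤len)) end
      ; f-inj = λ i i′ li li′ q → +-cancelʳ-≡ j i i′ (f-inj (i + j) (i′ + j) (inside li) (inside li′) q)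
      ; f-adj = λ i li → f-adj (i + j) (inside li)
      ; parity = tail-parity }
      where
      inside : ∀ {i} → i ≤ len ∸ j → i + j ≤ len
      inside {i} li = subst (i + j ≤_) (m∸n+n≡m j≤len) (+-monoˡ-≤ j li)
      tail-parity : odd (len ∸ j) ≡ not b
      tail-parity = begin
        odd (len ∸ j)                      ≡⟨ sym (xor-cancelʳ (odd (len ∸ j)) true) ⟩
        (odd (len ∸ j) xor true) xor true  ≡⟨ cong (λ o → (odd (len ∸ j) xor o) xor true) (sym odd-j) ⟩
        (odd (len ∸ j) xor odd j) xor true ≡⟨ cong (_xor true) (sym (odd-+ (len ∸ j) j)) ⟩
        odd (len ∸ j + j) xor true         ≡⟨ cong (λ m → odd m xor true) (m∸n+n≡m j≤len) ⟩
        odd len xor true                   ≡⟨ cong (_xor true) parity ⟩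
        b xor true                         ≡⟨ xor-comm b true ⟩
        not b                              ∎
        where open ≡-Reasoning

    closeUp : ∀ {x} → adj Y x x₁ ≡ true → ∀ j → suc j ≤ len → f (suc j) ≡ x → odd (suc (suc j)) ≡ true →
              OddCycleSeq
    closeUp {x} e j lj fj≡x odd-ℓ with odd⇒cycleLength j odd-ℓ
    ... | k , ℓ≡ = k , (x ◂ f) , subst (IsCycle (x ◂ f)) ℓ≡ cycle
      where
      below : ∀ {i} → i < suc (suc j) → i ≤ len
      below i<ℓ = ≤-trans (s≤s⁻¹ i<ℓ) lj
      x-only-last : ∀ i → i < suc j → f i ≢ x
      x-only-last i i<j fi≡x =
        <-irrefl (f-inj i (suc j) (≤-trans (<⇒≤ i<j) lj) lj (trans fi≡x (sym fj≡x))) i<j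
      cycle : IsCycle (x ◂ f) (suc (suc j))
      cycle = record { g-inj = inj ; g-adj = adjacent ; closes = fj≡x }
        where
        inj : ∀ i i′ → i < suc (suc j) → i′ < suc (suc j) → (x ◂ f) i ≡ (x ◂ f) i′ → i ≡ i′
        inj zero    zero     _  _   _ = refl
        inj zero    (suc i′) _  li′ q = ⊥-elim (x-only-last i′ (s≤s⁻¹ li′) (sym q))
        inj (suc i) zero     li _   q = ⊥-elim (x-only-last i (s≤s⁻¹ li) q)
        inj (suc i) (suc i′) li li′ q = cong suc (f-inj i i′ (below (<⇒≤ li)) (below (<⇒≤ li′)) q)
        adjacent : ∀ i → i < suc (suc j) → adj Y ((x ◂ f) i) ((x ◂ f) (suc i)) ≡ true
        adjacent zero    _  = subst (λ z → adj Y x z ≡ true) (sym start) e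
        adjacent (suc i) li = f-adj i (<-≤-trans (s≤s⁻¹ li) lj)

  walk⇒path : ∀ {x y b} → Walk x y b → Path x y b ⊎ OddCycleSeq
  walk⇒path []            = inj₁ trivialPath
  walk⇒path {x} (e ∷ w) with walk⇒path w
  ... | inj₂ c = inj₂ c
  ... | inj₁ P with find P x
  ...   | inj₁ fresh               = inj₁ (extend P e fresh)
  ...   | inj₂ (zero , _ , f0≡x)   = ⊥-elim (adj-≢ Y e (trans (sym f0≡x) (Path.start P)))
  ...   | inj₂ (suc j , lj , fj≡x) with odd (suc (suc j)) in odd-ℓ
  ...     | true  = inj₂ (closeUp P e j lj fj≡x odd-ℓ)
  ...     | false = inj₁ (shortcut P (suc j) lj fj≡x (trans (sym (not-involutive _)) (cong not odd-ℓ)))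

  -- A closed path has length 0, so an odd closed walk contains an odd cycle.
  oddClosedWalk⇒cycle : OddClosedWalk → OddCycleSeq
  oddClosedWalk⇒cycle (x , w) with walk⇒path w
  ... | inj₂ c = c
  ... | inj₁ P = case trans (cong odd len≡0) parity of λ ()
    where
    open Path P
    len≡0 : 0 ≡ len
    len≡0 = f-inj 0 len z≤n ≤-refl (trans start (sym end))

module _ {n m} (v : Fin (suc (suc m)) → Fin n) where

  some-step? : ∀ x y → Dec (∃ λ t → Step v t x y)
  some-step? x y = any? (λ t → step? v t x y)

  cycleGraph : Injective _≡_ _≡_ v → Graph n
  cycleGraph v-inj = record
    { adj    = λ x y → does (some-step? x y)
    ; sym    = λ x y → does-⇔ (mk⇔ (Prod.map₂ Sum.swap) (Prod.map₂ Sum.swap)) (some-step? x y) (some-step? y x)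
    ; irrefl = λ x → dec-false (some-step? x x) λ { (t , st) → next-≢ t (sym (v-inj (loop st))) } }
    where
    loop : ∀ {t x} → Step v t x x → v t ≡ v (next t)
    loop (inj₁ (x≡ , x≡′)) = trans (sym x≡) x≡′
    loop (inj₂ (x≡ , x≡′)) = trans (sym x≡) x≡′

  cycleGraph-traces : (v-inj : Injective _≡_ _≡_ v) → Traces (cycleGraph v-inj) v
  cycleGraph-traces v-inj x y = does-true (some-step? x y) , dec-true (some-step? x y)

module _ {n} (Y : Graph n) where
  open Cycles Y

  oddCycleSeq⇒oddCycle : OddCycleSeq → Σ (Graph n) (OddCycle Y)
  oddCycleSeq⇒oddCycle (k , g , cyc) = cycleGraph v v-inj , C⊆Y , k , v , v-inj , cycleGraph-traces v v-inj
    where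
    open IsCycle cyc
    v : Fin (suc (suc (suc (k + k)))) → Fin n
    v t = g (toℕ t)
    v-inj : Injective _≡_ _≡_ v
    v-inj {a} {b} e = toℕ-injective (g-inj _ _ (toℕ<n a) (toℕ<n b) e)
    step-adj : ∀ t → adj Y (v t) (v (next t)) ≡ true
    step-adj t with next-cases t
    ... | inj₁ next≡ = subst (λ i → adj Y (v t) (g i) ≡ true) (sym next≡) (g-adj (toℕ t) (toℕ<n t))
    ... | inj₂ (last , next≡0) =
      subst (λ i → adj Y (v t) (g i) ≡ true) (sym next≡0)
            (subst (λ z → adj Y (v t) z ≡ true) (trans (cong (g ∘ suc) last) closes) (g-adj (toℕ t) (toℕ<n t)))
    C⊆Y : cycleGraph v v-inj ⊆G Y
    C⊆Y x y e with does-true (some-step? v x y) e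
    ... | t , inj₁ (refl , refl) = step-adj t
    ... | t , inj₂ (refl , refl) = trans (Graph.sym Y _ _) (step-adj t)

bipartite-or-oddCycle : ∀ {n} (Y : Graph n) → Bipartite Y ⊎ Σ (Graph n) (OddCycle Y)
bipartite-or-oddCycle Y =
  Sum.map₂ (oddCycleSeq⇒oddCycle Y ∘ Cycles.oddClosedWalk⇒cycle Y) (Colouring.bipartite-or-oddWalk Y)

module _ {A : Set} where

  sum-mono : ∀ (f g : A → ℕ) {l} → All (λ a → f a ≤ g a) l → sum (map f l) ≤ sum (map g l)
  sum-mono f g []         = z≤n
  sum-mono f g (le ∷ les) = +-mono-≤ le (sum-mono f g les)

  sum-strict : ∀ (f g : A → ℕ) {l x} → (∀ a → f a ≤ g a) → x ∈ l → f x < g x →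
               suc (sum (map f l)) ≤ sum (map g l)
  sum-strict f g {a ∷ l} le (here refl) lt = +-mono-≤ lt (sum-mono f g {l} (All.tabulate λ {b} _ → le b))
  sum-strict f g {a ∷ l} le (there x∈l) lt =
    subst (_≤ sum (map g (a ∷ l))) (+-suc (f a) _) (+-mono-≤ (le a) (sum-strict f g le x∈l lt))

  sum-except-one : DecidableEquality A → ∀ (f g : A → ℕ) (a₀ : A) {l} → Unique l →
                   (∀ a → a ≢ a₀ → f a ≤ g a) → f a₀ ≤ suc (g a₀) → sum (map f l) ≤ suc (sum (map g l))
  sum-except-one _≟_ f g a₀ {[]}    _            le le₀ = z≤n
  sum-except-one _≟_ f g a₀ {a ∷ l} (a∉l AllPairs.∷ uniq) le le₀ with a ≟ a₀
  ... | yes refl = +-mono-≤ le₀ (sum-mono f g (All.map (λ {b} a≢b → le b (a≢b ∘ sym)) a∉l))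
  ... | no a≢a₀  = subst (sum (map f (a ∷ l)) ≤_) (+-suc (g a) _)
                         (+-mono-≤ (le a a≢a₀) (sum-except-one _≟_ f g a₀ uniq le le₀))

record Orientation {n} (a b : Fin n) : Set where
  field
    lo hi      : Fin n
    same       : SamePair a b lo hi
    increasing : lo <ᶠ hi ≡ true
    unique     : ∀ {x y} → SamePair a b x y → x <ᶠ y ≡ true → (x , y) ≡ (lo , hi)

orientation : ∀ {n} {a b : Fin n} → a ≢ b → Orientation a b
orientation {a = a} {b} a≢b with <ᶠ-orient a≢b
... | inj₁ (a<b , b≮a) = record { lo = a ; hi = b ; same = inj₁ (refl , refl) ; increasing = a<b ; unique = unique }
  where
  unique : ∀ {x y} → SamePair a b x y → x <ᶠ y ≡ true → (x , y) ≡ (a , b)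
  unique (inj₁ (refl , refl)) _   = refl
  unique (inj₂ (refl , refl)) b<a = case trans (sym b≮a) b<a of λ ()
... | inj₂ (a≮b , b<a) = record { lo = b ; hi = a ; same = inj₂ (refl , refl) ; increasing = b<a ; unique = unique }
  where
  unique : ∀ {x y} → SamePair a b x y → x <ᶠ y ≡ true → (x , y) ≡ (b , a)
  unique (inj₁ (refl , refl)) a<b = case trans (sym a≮b) a<b of λ ()
  unique (inj₂ (refl , refl)) _   = refl

adj-SamePair : ∀ {n} (G : Graph n) {a b x y} → SamePair a b x y → adj G x y ≡ adj G a b
adj-SamePair G (inj₁ (refl , refl)) = refl
adj-SamePair G (inj₂ (refl , refl)) = Graph.sym G _ _

pairs : ∀ n → List (Fin n × Fin n)
pairs n = cartesianProduct (allFin n) (allFin n)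

∈-pairs : ∀ {n} (x y : Fin n) → (x , y) ∈ pairs n
∈-pairs x y = ∈-cartesianProduct⁺ (∈-allFin x) (∈-allFin y)

edgeTerm : ∀ {n} → Graph n → Fin n × Fin n → ℕ
edgeTerm G p = if adj G (proj₁ p) (proj₂ p) ∧ (proj₁ p <ᶠ proj₂ p) then 1 else 0

edgeTerm-value : ∀ {n} (G : Graph n) {x y a o} → adj G x y ≡ a → x <ᶠ y ≡ o →
                 edgeTerm G (x , y) ≡ (if a ∧ o then 1 else 0)
edgeTerm-value G xy o = cong₂ (λ a o → if a ∧ o then 1 else 0) xy o

edgeTerm-≤1 : ∀ {n} (G : Graph n) p → edgeTerm G p ≤ 1
edgeTerm-≤1 G p with adj G (proj₁ p) (proj₂ p) ∧ (proj₁ p <ᶠ proj₂ p)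
... | true  = ≤-refl
... | false = z≤n

edgeTerm-mono : ∀ {n} {H G : Graph n} → H ⊆G G → ∀ p → edgeTerm H p ≤ edgeTerm G p
edgeTerm-mono {H = H} H⊆G (x , y) with adj H x y in e
... | false = z≤n
... | true rewrite H⊆G x y e = ≤-refl

edgeCount-strict : ∀ {n} {H G : Graph n} → H ⊆G G → ∀ {x y} → adj G x y ≡ true → adj H x y ≡ false →
                   suc (edgeCount H) ≤ edgeCount G
edgeCount-strict {n} {H} {G} H⊆G {x} {y} inG notH =
  sum-strict (edgeTerm H) (edgeTerm G) (edgeTerm-mono {H = H} {G} H⊆G) (∈-pairs lo hi) drop
  where
  open Orientation (orientation (adj-≢ G inG))
  drop : edgeTerm H (lo , hi) < edgeTerm G (lo , hi)
  drop = subst₂ _<_ (sym (edgeTerm-value H (trans (adj-SamePair H same) notH) increasing))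
                    (sym (edgeTerm-value G (trans (adj-SamePair G same) inG) increasing)) ≤-refl

deleted? : ∀ {n} (a b x y : Fin n) → Dec (SamePair a b x y)
deleted? a b x y = map′ (Sum.map₂ Prod.swap) (Sum.map₂ Prod.swap)
                        (((x F.≟ a) ×-dec (y F.≟ b)) ⊎-dec ((x F.≟ b) ×-dec (y F.≟ a)))

deleteEdge-adj : ∀ {n} (G : Graph n) a b x y → adj (deleteEdge G a b) x y ≡ adj G x y ∧ not (does (deleted? a b x y))
deleteEdge-adj G a b x y =
  cong (λ d → adj G x y ∧ not d)
       (cong₂ _∨_ (cong₂ _∧_ (isYes≗does (x F.≟ a)) (isYes≗does (y F.≟ b)))
                  (cong₂ _∧_ (isYes≗does (x F.≟ b)) (isYes≗does (y F.≟ a))))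

deleteEdge-⊆ : ∀ {n} (G : Graph n) a b → deleteEdge G a b ⊆G G
deleteEdge-⊆ G a b x y e = proj₁ (∧-true (adj G x y) e)

deleteEdge-removes : ∀ {n} (G : Graph n) a b → adj (deleteEdge G a b) a b ≡ false
deleteEdge-removes G a b
  rewrite deleteEdge-adj G a b a b | dec-true (deleted? a b a b) (inj₁ (refl , refl)) = ∧-zeroʳ (adj G a b)

deleteEdge-keeps : ∀ {n} (G : Graph n) {a b x y} → adj G x y ≡ true → ¬ SamePair a b x y →
                   adj (deleteEdge G a b) x y ≡ true
deleteEdge-keeps G {a} {b} {x} {y} e other
  rewrite deleteEdge-adj G a b x y | e | dec-false (deleted? a b x y) other = refl

deleteEdge-removed : ∀ {n} (G : Graph n) {a b} → a ≢ b → removed G (deleteEdge G a b) ≤ 1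
deleteEdge-removed {n} G {a} {b} a≢b =
  m≤n+o⇒m∸n≤o (edgeCount G) (edgeCount D)
    (subst (edgeCount G ≤_) (+-comm 1 (edgeCount D))
      (sum-except-one (≡-dec F._≟_ F._≟_) (edgeTerm G) (edgeTerm D) (lo , hi)
         (UniqueP.cartesianProduct⁺ (UniqueP.allFin⁺ n) (UniqueP.allFin⁺ n))
         elsewhere (≤-trans (edgeTerm-≤1 G (lo , hi)) (s≤s z≤n))))
  where
  D : Graph n
  D = deleteEdge G a b
  open Orientation (orientation a≢b)
  elsewhere : ∀ p → p ≢ (lo , hi) → edgeTerm G p ≤ edgeTerm D p
  elsewhere (x , y) p≢ with adj G x y ∧ (x <ᶠ y) in counted
  ... | false = z≤n
  ... | true  = ≤-reflexive (sym (edgeTerm-value D (deleteEdge-keeps G e other) x<y))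
    where
    e : adj G x y ≡ true
    e = proj₁ (∧-true (adj G x y) counted)
    x<y : x <ᶠ y ≡ true
    x<y = proj₂ (∧-true (adj G x y) counted)
    other : ¬ SamePair a b x y
    other sp = p≢ (unique sp x<y)

removed-two : ∀ {n} {H G : Graph n} → H ⊆G G → ∀ {x₁ y₁ x₂ y₂} →
              adj G x₁ y₁ ≡ true → adj H x₁ y₁ ≡ false → adj G x₂ y₂ ≡ true → adj H x₂ y₂ ≡ false →
              ¬ SamePair x₁ y₁ x₂ y₂ → 2 ≤ removed G H
removed-two {n} {H} {G} H⊆G {x₁} {y₁} inG₁ notH₁ inG₂ notH₂ different =
  m+n≤o⇒m≤o∸n 2 (≤-trans (s≤s (edgeCount-strict {H = H} {G₁} H⊆G₁ (deleteEdge-keeps G inG₂ different) notH₂))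
                          (edgeCount-strict {H = G₁} {G} (deleteEdge-⊆ G x₁ y₁) inG₁ (deleteEdge-removes G x₁ y₁)))
  where
  G₁ : Graph n
  G₁ = deleteEdge G x₁ y₁
  H⊆G₁ : H ⊆G G₁
  H⊆G₁ x y e = deleteEdge-keeps G (H⊆G x y e) λ sp →
    case trans (sym notH₁) (trans (sym (adj-SamePair H sp)) e) of λ ()

colourable-⊆ : ∀ {n} {H G : Graph n} {k} → H ⊆G G → Colorable G k → Colorable H k
colourable-⊆ H⊆G (c , proper) = c , λ x y e → proper x y (H⊆G x y e)

colourable-mono : ∀ {n} {Y : Graph n} {k m} → k ≤ m → Colorable Y k → Colorable Y m
colourable-mono k≤m (c , proper) =
  (λ z → F.inject≤ (c z) k≤m) , λ x y e same → proper x y e (inject≤-injective k≤m k≤m (c x) (c y) same)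

HasChi-unique : ∀ {n} {Y : Graph n} {k m} → HasChi Y k → HasChi Y m → k ≡ m
HasChi-unique {k = k} {m} (colk , mink) (colm , minm) with <-cmp k m
... | tri< k<m _ _ = ⊥-elim (minm k k<m colk)
... | tri≈ _ k≡m _ = k≡m
... | tri> _ _ m<k = ⊥-elim (mink m m<k colm)

HasChi-exact : ∀ {n} {Y : Graph n} {k} → Colorable Y (suc k) → ¬ Colorable Y k → HasChi Y (suc k)
HasChi-exact {Y = Y} col ¬col = col , λ m m<k+1 colm → ¬col (colourable-mono {Y = Y} (s≤s⁻¹ m<k+1) colm)

-- Deleting an edge lowers the chromatic number by at most one: give an endpoint a new colour.
deleteEdge-colourable : ∀ {n} (G : Graph n) {a b k} → Colorable (deleteEdge G a b) k → Colorable G (suc k)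
deleteEdge-colourable {n} G {a} {b} {k} (c , proper) = c′ , proper′
  where
  c′ : Fin n → Fin (suc k)
  c′ z with z F.≟ a
  ... | yes _ = F.fromℕ k
  ... | no  _ = F.inject₁ (c z)
  proper′ : ∀ x y → adj G x y ≡ true → c′ x ≢ c′ y
  proper′ x y e with x F.≟ a | y F.≟ a
  ... | yes refl | yes refl = ⊥-elim (adj-≢ G e refl)
  ... | yes _    | no  _    = fromℕ≢inject₁
  ... | no  _    | yes _    = fromℕ≢inject₁ ∘ sym
  ... | no  x≢a  | no  y≢a  = λ same → proper x y (deleteEdge-keeps G e other) (inject₁-injective same)
    where
    other : ¬ SamePair a b x y
    other (inj₁ (x≡a , _)) = x≢a x≡a
    other (inj₂ (y≡a , _)) = y≢a y≡a

⊆G-antisym : ∀ {n} {C D : Graph n} → C ⊆G D → D ⊆G C → SameEdges C D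
⊆G-antisym {C = C} {D} C⊆D D⊆C x y with adj C x y in c | adj D x y in d
... | true  | true  = refl
... | false | false = refl
... | true  | false = trans (sym (C⊆D x y c)) d
... | false | true  = sym (trans (sym (D⊆C x y d)) c)

⊆G-or-missing : ∀ {n} (C H : Graph n) → C ⊆G H ⊎ (∃ λ x → ∃ λ y → adj C x y ≡ true × adj H x y ≡ false)
⊆G-or-missing C H with any? (λ x → any? (λ y → (adj C x y Bool.≟ true) ×-dec (adj H x y Bool.≟ false)))
... | yes missing = inj₂ missing
... | no none     = inj₁ included
  where
  included : C ⊆G H
  included x y e with adj H x y in h
  ... | true  = refl
  ... | false = ⊥-elim (none (x , y , e , h))

oddCycle-missing-edge : ∀ {n} {G C H : Graph n} → OddCycle G C → Bipartite H →
                        ∃ λ x → ∃ λ y → adj C x y ≡ true × adj H x y ≡ false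
oddCycle-missing-edge {G = G} {C} {H} odd bip with ⊆G-or-missing C H
... | inj₁ C⊆H    = ⊥-elim (oddCycle-not-bipartite {G = G} {C} {H} odd C⊆H bip)
... | inj₂ missing = missing

oddCycle-⊆ : ∀ {n} {Y G D : Graph n} → Y ⊆G G → OddCycle Y D → OddCycle G D
oddCycle-⊆ Y⊆G (D⊆Y , rest) = (λ x y → Y⊆G x y ∘ D⊆Y x y) , rest

avoiding-⊆ : ∀ {n} {G C : Graph n} {a b} → C ⊆G G → adj C a b ≡ false → C ⊆G deleteEdge G a b
avoiding-⊆ {G = G} {C} C⊆G avoids x y e = deleteEdge-keeps G (C⊆G x y e) λ sp →
  case trans (sym avoids) (trans (sym (adj-SamePair C sp)) e) of λ ()

-- A bipartite subgraph H of Y misses an edge of each of two edge-disjoint odd cycles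
-- inside Y, so at least two edges of Y are removed.
disjoint-oddCycles-removed : ∀ {n} {G Y H Ca Cb : Graph n} → H ⊆G Y → Bipartite H →
                             OddCycle G Ca → OddCycle G Cb → Ca ⊆G Y → Cb ⊆G Y →
                             (∀ x y → adj Ca x y ≡ true → adj Cb x y ≡ false) → 2 ≤ removed Y H
disjoint-oddCycles-removed {G = G} {Y} {H} {Ca} {Cb} H⊆Y bip odd-a odd-b Ca⊆Y Cb⊆Y disjoint =
  combine (oddCycle-missing-edge {G = G} {Ca} {H} odd-a bip) (oddCycle-missing-edge {G = G} {Cb} {H} odd-b bip)
  where
  combine : (∃ λ x → ∃ λ y → adj Ca x y ≡ true × adj H x y ≡ false) →
            (∃ λ x → ∃ λ y → adj Cb x y ≡ true × adj H x y ≡ false) → 2 ≤ removed Y H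
  combine (x₁ , y₁ , in-a , notH₁) (x₂ , y₂ , in-b , notH₂) =
    removed-two {H = H} {Y} H⊆Y (Ca⊆Y x₁ y₁ in-a) notH₁ (Cb⊆Y x₂ y₂ in-b) notH₂ different
    where
    different : ¬ SamePair x₁ y₁ x₂ y₂
    different sp = case trans (sym (disjoint x₁ y₁ in-a)) (trans (sym (adj-SamePair Cb sp)) in-b) of λ ()

module Critical {n} {G : Graph n} (critical : Critical32 G) where

  χ=3 : HasChi G 3
  χ=3 = proj₁ critical

  χ-of-subgraph : ∀ {Y C : Graph n} {k} → Y ⊆G G → OddCycle G C → C ⊆G Y → HasChi Y k → k ≡ 3
  χ-of-subgraph {Y} {C} Y⊆G odd C⊆Y χk =
    HasChi-unique {Y = Y} χk (HasChi-exact {Y = Y} (colourable-⊆ {H = Y} {G} Y⊆G (proj₁ χ=3))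
                                   (oddCycle-not-bipartite {G = G} {C} {Y} odd C⊆Y ∘ 2-colourable⇒bipartite {Y = Y}))

  -- Since es_χ(G) = 2, deleting one edge never leaves a bipartite graph.
  deleteEdge-not-bipartite : ∀ {a b} → adj G a b ≡ true → ¬ Bipartite (deleteEdge G a b)
  deleteEdge-not-bipartite {a} {b} e bip with proj₁ (proj₂ critical)
  ... | k , χk , _ , minimal = case ≤-trans two≤removed (deleteEdge-removed G (adj-≢ G e)) of λ { (s≤s ()) }
    where
    χ-deleted : HasChi (deleteEdge G a b) 2
    χ-deleted = HasChi-exact {Y = deleteEdge G a b} (bipartite⇒2-colourable {Y = deleteEdge G a b} bip)
                             (λ col₁ → proj₂ χ=3 2 ≤-refl (deleteEdge-colourable G {a} {b} col₁))
    two≤removed : 2 ≤ removed G (deleteEdge G a b)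
    two≤removed = minimal (deleteEdge G a b) (deleteEdge-⊆ G a b)
                          (subst (λ k → HasChi (deleteEdge G a b) (k ∸ 1)) (HasChi-unique {Y = G} χ=3 χk) χ-deleted)

  -- Since es_χ(G - e) < 2 for every edge e, two edge-disjoint odd cycles cannot both avoid e.
  avoiding-cycles-meet : ∀ {a b} {Ca Cb : Graph n} → adj G a b ≡ true →
                         OddCycle G Ca → OddCycle G Cb → adj Ca a b ≡ false → adj Cb a b ≡ false →
                         (∀ x y → adj Ca x y ≡ true → adj Cb x y ≡ false) → ⊥
  avoiding-cycles-meet {a} {b} {Ca} {Cb} e odd-a odd-b avoid-a avoid-b disjoint = refute (proj₂ (proj₂ critical) a b e)
    where
    Ca⊆ : Ca ⊆G deleteEdge G a b
    Ca⊆ = avoiding-⊆ {G = G} {Ca} (proj₁ odd-a) avoid-a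
    Cb⊆ : Cb ⊆G deleteEdge G a b
    Cb⊆ = avoiding-⊆ {G = G} {Cb} (proj₁ odd-b) avoid-b
    refute : (Σ ℕ λ m → EsChi (deleteEdge G a b) m × m < 2) → ⊥
    refute (m , (k , χk , (H , H⊆ , χH , removed≡m) , _) , m<2) =
      <-irrefl refl (≤-<-trans (subst (2 ≤_) removed≡m two≤removed) m<2)
      where
      H-bipartite : Bipartite H
      H-bipartite = 2-colourable⇒bipartite {Y = H}
        (subst (λ k → Colorable H (k ∸ 1)) (χ-of-subgraph {deleteEdge G a b} {Ca} (deleteEdge-⊆ G a b) odd-a Ca⊆ χk) (proj₁ χH))
      two≤removed : 2 ≤ removed (deleteEdge G a b) H
      two≤removed = disjoint-oddCycles-removed {G = G} {deleteEdge G a b} {H} {Ca} {Cb} H⊆ H-bipartite odd-a odd-b Ca⊆ Cb⊆ disjoint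

  no-isolated-cycle : ∀ {Ci Cj Ck : Graph n} → OddCycle G Ci → OddCycle G Cj → OddCycle G Ck →
                      (∀ x y → adj Ci x y ≡ true → adj Cj x y ≡ false × adj Ck x y ≡ false) →
                      ¬ SameEdges Cj Ck → ⊥
  no-isolated-cycle {Ci} {Cj} {Ck} odd-i odd-j odd-k isolated j≠k
    with ⊆G-or-missing Cj Ck | ⊆G-or-missing Ck Cj
  ... | inj₁ j⊆k | inj₁ k⊆j = j≠k (⊆G-antisym {C = Cj} {Ck} j⊆k k⊆j)
  ... | inj₂ (x , y , in-j , not-k) | _ =
    avoiding-cycles-meet {Ca = Ci} {Ck} (proj₁ odd-j x y in-j) odd-i odd-k
                         (¬-not (λ in-i → case trans (sym (proj₁ (isolated x y in-i))) in-j of λ ())) not-k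
                         (λ x y → proj₂ ∘ isolated x y)
  ... | inj₁ _ | inj₂ (x , y , in-k , not-j) =
    avoiding-cycles-meet {Ca = Ci} {Cj} (proj₁ odd-k x y in-k) odd-i odd-j
                         (¬-not (λ in-i → case trans (sym (proj₂ (isolated x y in-i))) in-k of λ ())) not-j
                         (λ x y → proj₁ ∘ isolated x y)

symDiff₃ : ∀ {n} → Graph n → Graph n → Graph n → Graph n
symDiff₃ C₁ C₂ C₃ = record
  { adj    = λ x y → (adj C₁ x y xor adj C₂ x y) xor adj C₃ x y
  ; sym    = λ x y → cong₂ _xor_ (cong₂ _xor_ (Graph.sym C₁ x y) (Graph.sym C₂ x y)) (Graph.sym C₃ x y)
  ; irrefl = λ x → cong₂ _xor_ (cong₂ _xor_ (Graph.irrefl C₁ x) (Graph.irrefl C₂ x)) (Graph.irrefl C₃ x) }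

symDiff₃-⊆ : ∀ {n} {G C₁ C₂ C₃ : Graph n} → C₁ ⊆G G → C₂ ⊆G G → C₃ ⊆G G → symDiff₃ C₁ C₂ C₃ ⊆G G
symDiff₃-⊆ {C₁ = C₁} {C₂} {C₃} s₁ s₂ s₃ x y e with adj C₁ x y in e₁ | adj C₂ x y in e₂ | adj C₃ x y in e₃
... | true  | _     | _    = s₁ x y e₁
... | false | true  | _    = s₂ x y e₂
... | false | false | true = s₃ x y e₃

-- Three odd cycles have a non-bipartite symmetric difference: under any colouring it has
-- an odd number of monochromatic edges, as each of the three cycles does.
symDiff₃-not-bipartite : ∀ {n} {G C₁ C₂ C₃ : Graph n} → OddCycle G C₁ → OddCycle G C₂ → OddCycle G C₃ →
                         ¬ Bipartite (symDiff₃ C₁ C₂ C₃)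
symDiff₃-not-bipartite {G = G} {C₁} {C₂} {C₃} odd₁ odd₂ odd₃ (c , proper) =
  case trans (sym (edgeParity-proper (adj (symDiff₃ C₁ C₂ C₃)) c proper)) odd-many of λ ()
  where
  odd-many : edgeParity (adj (symDiff₃ C₁ C₂ C₃)) (agree c) ≡ true
  odd-many =
    begin
      edgeParity (adj (symDiff₃ C₁ C₂ C₃)) (agree c)
    ≡⟨ edgeParity-xor (λ x y → adj C₁ x y xor adj C₂ x y) (adj C₃) (agree c) ⟩
      edgeParity (λ x y → adj C₁ x y xor adj C₂ x y) (agree c) xor edgeParity (adj C₃) (agree c)
    ≡⟨ cong (_xor edgeParity (adj C₃) (agree c)) (edgeParity-xor (adj C₁) (adj C₂) (agree c)) ⟩
      (edgeParity (adj C₁) (agree c) xor edgeParity (adj C₂) (agree c)) xor edgeParity (adj C₃) (agree c)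
    ≡⟨ cong₂ _xor_ (cong₂ _xor_ (oddCycle-monochromatic {G = G} {C₁} odd₁ c)
                                (oddCycle-monochromatic {G = G} {C₂} odd₂ c))
                   (oddCycle-monochromatic {G = G} {C₃} odd₃ c) ⟩
      (true xor true) xor true
    ≡⟨⟩
      true
    ∎
    where open ≡-Reasoning

exactly-one : ∀ a b c → (a xor b) xor c ≡ true → ¬ (a ≡ true × b ≡ true × c ≡ true) →
              (a ≡ true → b ≡ false × c ≡ false) × (b ≡ true → a ≡ false × c ≡ false) × (c ≡ true → a ≡ false × b ≡ false)
exactly-one false false false ()   _
exactly-one false false true  _    _   = (λ ()) , (λ ()) , (λ _ → refl , refl)
exactly-one false true  false _    _   = (λ ()) , (λ _ → refl , refl) , (λ ())
exactly-one false true  true  ()   _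
exactly-one true  false false _    _   = (λ _ → refl , refl) , (λ ()) , (λ ())
exactly-one true  false true  ()   _
exactly-one true  true  false ()   _
exactly-one true  true  true  _    all = ⊥-elim (all (refl , refl , refl))

deleteEdge-lost : ∀ {n} (G : Graph n) {a b} {C : Graph n} → C ⊆G deleteEdge G a b → adj C a b ≡ true → ⊥
deleteEdge-lost G {a} {b} C⊆ e = case trans (sym (deleteEdge-removes G a b)) (C⊆ a b e) of λ ()

module ThreeCycles {n} {G : Graph n} (critical : Critical32 G) {C₁ C₂ C₃ : Graph n}
                   (odd₁ : OddCycle G C₁) (odd₂ : OddCycle G C₂) (odd₃ : OddCycle G C₃)
                   (only : ∀ C → OddCycle G C → SameEdges C C₁ ⊎ SameEdges C C₂ ⊎ SameEdges C C₃) where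
  open Critical {G = G} critical

  -- By König's theorem, a subgraph of G is bipartite unless it contains one of the three cycles.
  bipartite-or-contains : ∀ {Y} → Y ⊆G G → Bipartite Y ⊎ (C₁ ⊆G Y ⊎ C₂ ⊆G Y ⊎ C₃ ⊆G Y)
  bipartite-or-contains {Y} Y⊆G with bipartite-or-oddCycle Y
  ... | inj₁ bip        = inj₁ bip
  ... | inj₂ (D , oddD) =
    inj₂ (Sum.map (contained {C₁}) (Sum.map (contained {C₂}) (contained {C₃}))
                  (only D (oddCycle-⊆ {Y = Y} {G} {D} Y⊆G oddD)))
    where
    contained : ∀ {C} → SameEdges D C → C ⊆G Y
    contained same x y e = proj₁ oddD x y (trans (same x y) e)

  -- No edge lies on all three cycles: deleting it would leave G bipartite.
  no-common-edge : ∀ {a b} → adj C₁ a b ≡ true → adj C₂ a b ≡ true → adj C₃ a b ≡ true → ⊥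
  no-common-edge {a} {b} e₁ e₂ e₃ with bipartite-or-contains {deleteEdge G a b} (deleteEdge-⊆ G a b)
  ... | inj₁ bip             = deleteEdge-not-bipartite (proj₁ odd₁ a b e₁) bip
  ... | inj₂ (inj₁ s)        = deleteEdge-lost G {C = C₁} s e₁
  ... | inj₂ (inj₂ (inj₁ s)) = deleteEdge-lost G {C = C₂} s e₂
  ... | inj₂ (inj₂ (inj₂ s)) = deleteEdge-lost G {C = C₃} s e₃

  lone : ∀ x y → adj (symDiff₃ C₁ C₂ C₃) x y ≡ true →
         (adj C₁ x y ≡ true → adj C₂ x y ≡ false × adj C₃ x y ≡ false) ×
         (adj C₂ x y ≡ true → adj C₁ x y ≡ false × adj C₃ x y ≡ false) ×
         (adj C₃ x y ≡ true → adj C₁ x y ≡ false × adj C₂ x y ≡ false)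
  lone x y inY = exactly-one (adj C₁ x y) (adj C₂ x y) (adj C₃ x y) inY λ (e₁ , e₂ , e₃) → no-common-edge e₁ e₂ e₃

  -- The symmetric difference of the three cycles is not bipartite, so it contains one of
  -- them; that cycle is then edge-disjoint from the other two, which must coincide.
  impossible : ¬ SameEdges C₁ C₂ → ¬ SameEdges C₁ C₃ → ¬ SameEdges C₂ C₃ → ⊥
  impossible ≠₁₂ ≠₁₃ ≠₂₃
    with bipartite-or-contains {symDiff₃ C₁ C₂ C₃} (symDiff₃-⊆ {G = G} {C₁} {C₂} {C₃} (proj₁ odd₁) (proj₁ odd₂) (proj₁ odd₃))
  ... | inj₁ bip             = symDiff₃-not-bipartite {G = G} {C₁} {C₂} {C₃} odd₁ odd₂ odd₃ bip
  ... | inj₂ (inj₁ s)        = no-isolated-cycle {C₁} {C₂} {C₃} odd₁ odd₂ odd₃ (λ x y e → proj₁ (lone x y (s x y e)) e) ≠₂₃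
  ... | inj₂ (inj₂ (inj₁ s)) = no-isolated-cycle {C₂} {C₁} {C₃} odd₂ odd₁ odd₃ (λ x y e → proj₁ (proj₂ (lone x y (s x y e))) e) ≠₁₃
  ... | inj₂ (inj₂ (inj₂ s)) = no-isolated-cycle {C₃} {C₁} {C₂} odd₃ odd₁ odd₂ (λ x y e → proj₂ (proj₂ (lone x y (s x y e))) e) ≠₁₂

theorem2p4 : (n : ℕ) (G : Graph n) → Critical32 G → ¬ ExactlyThreeOddCycles G
theorem2p4 n G critical (C₁ , C₂ , C₃ , odd₁ , odd₂ , odd₃ , ≠₁₂ , ≠₁₃ , ≠₂₃ , only) =
  ThreeCycles.impossible {G = G} critical {C₁} {C₂} {C₃} odd₁ odd₂ odd₃ only ≠₁₂ ≠₁₃ ≠₂₃
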